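{- Let $A$ be a finite $0/1$-word containing at least one $1$, and let $A'$ be obtained from $A$ by one move of the no-gaps coin-removal process (remove a letter $1$, complement each of its at most two immediate neighbours, and concatenate the remaining letters). Suppose $A'$ also contains at least one $1$. Then $S(A)\equiv 2\pmod 3$ if and only if $S(A')\equiv 2\pmod 3$, where $S$ denotes the parity sum.
   Context: Words over $\{0,1\}$ encode rows of coins, $1$ = heads-up, $0$ = tails-up. In the no-gaps process, a move removes a heads-up coin, flips the coins immediately to its left and right (those that exist), and then pushes the remaining coins together so that the coins formerly on either side of the removed coin become adjacent. For a word $A$ containing at least one $1$, write $A = 1^{h_0}0^{t_1}1^{h_1}0^{t_2}\cdots 1^{h_{n-1}}0^{t_n}1^{h_n}$ with $n\ge 1$ and non-negative integers $h_i,t_i$ ($x^k$ means $k$ copies of $x$, $x^0$ empty). Put $p_i=(t_1+\dots+t_i)\bmod 2$ and define the parity sum $S(A)=h_0+\sum_{i=1}^n(-1)^{p_i}h_i-p_n$; its value does not depend on the chosen decomposition. -}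

module Defs where

open import Data.Bool using (Bool; true; false; not)
open import Data.Nat using (ℕ; zero; suc; _+_)
open import Data.Integer using (ℤ; +_; -_; _-_) renaming (_+_ to _+ℤ_)
open import Data.List using (List; []; _∷_; _++_; replicate; [_])
open import Data.Empty using (⊥)
open import Data.Unit using (⊤)
open import Data.Product using (_×_; _,_)

-- A word over {0,1}: true = 1 (heads-up), false = 0 (tails-up).
Word : Set
Word = List Bool

flipLast : Word → Word
flipLast []           = []
flipLast (x ∷ [])     = not x ∷ []
flipLast (x ∷ y ∷ xs) = x ∷ flipLast (y ∷ xs)

flipHead : Word → Word
flipHead []       = []
flipHead (x ∷ xs) = not x ∷ xs

data Move : Word → Word → Set where
  move : (L R : Word) → Move (L ++ true ∷ R) (flipLast L ++ flipHead R)

-- Decomposition A = 1^{h0} 0^{t1} 1^{h1} ... 0^{tn} 1^{hn}: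
-- h0 together with the list of pairs (t_i , h_i), i = 1..n.
record Decomp : Set where
  constructor decomp
  field
    h₀    : ℕ
    rest  : List (ℕ × ℕ)

decode-rest : List (ℕ × ℕ) → Word
decode-rest []             = []
decode-rest ((t , h) ∷ ds) = replicate t false ++ replicate h true ++ decode-rest ds

decode : Decomp → Word
decode (decomp h₀ ds) = replicate h₀ true ++ decode-rest ds

NonEmptyRest : Decomp → Set
NonEmptyRest (decomp _ [])      = ⊥
NonEmptyRest (decomp _ (_ ∷ _)) = ⊤

odd : ℕ → Bool
odd zero    = false
odd (suc n) = not (odd n)

xor : Bool → Bool → Bool
xor false b = b
xor true  b = not b

sign : Bool → ℕ → ℤ
sign false h = + h
sign true  h = - (+ h)

toℤ : Bool → ℤ
toℤ false = + 0
toℤ true  = + 1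

S-rest : Bool → List (ℕ × ℕ) → ℤ
S-rest p []             = - toℤ p
S-rest p ((t , h) ∷ ds) = let p' = xor p (odd t) in sign p' h +ℤ S-rest p' ds

-- Parity sum S(A) = h0 + Σ_{i=1}^n (-1)^{p_i} h_i - p_n, p_i = (t_1+...+t_i) mod 2.
S : Decomp → ℤ
S (decomp h₀ ds) = + h₀ +ℤ S-rest false ds

{-# OPTIONS --safe #-}
-- Read from the right, a head acts on ℤ by x ↦ 1 + x and a tail by x ↦ -x;
-- starting from -1 this yields signedCount, and S ≡ 1 + signedCount (mod 3).
-- Both maps respect congruence mod 3, so only the letters touched by a move
-- matter.  Removing a leading head sends signedCount to 2 - signedCount, a
-- reflection fixing 1 mod 3.  Removing any other head replaces x1y by
-- (¬x)(¬y) (or a final x1 by ¬x, which changes nothing), and by the same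
-- reflection identity these two blocks act alike up to a shift by ±3.
module Submission where

open import Defs
open import Data.Bool using (Bool; true; false; not)
open import Data.Integer using (ℤ; +_)
open import Data.Integer.DivMod using (_%ℕ_)
open import Data.List.Membership.Propositional using (_∈_)
open import Relation.Binary.PropositionalEquality using (_≡_)
open import Function.Bundles using (_⇔_)

open import Level using (0ℓ)
open import Data.Nat as ℕ using (ℕ; zero; suc; NonZero)
open import Data.Nat.Properties using (≤-<-trans; ⊔-lub; n<1+n)
open import Data.Nat.Divisibility using (>⇒∤) renaming (_∣_ to _∣ℕ_)
open import Data.Integer using (-_; _+_; _-_; _*_; ∣_∣; 0ℤ; 1ℤ; -1ℤ)
open import Data.Integer.Properties
  using (+-inverseʳ; +-comm; +-assoc; +-identityˡ; +-minus-telescope; +-injective;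
         neg-involutive; neg-distrib-+; m-n≡m⊖n; ∣m⊝n∣≤m⊔n; ∣i∣≡0⇒i≡0; i-j≡0⇒i≡j;
         +-commutativeSemigroup)
open import Data.Integer.DivMod using (_/ℕ_; a≡a%ℕn+[a/ℕn]*n; n%ℕd<d)
open import Data.Integer.Divisibility.Signed using (_∣_; divides; ∣⇒∣ᵤ; ∣m∣n⇒∣m+n; ∣m⇒∣-m)
open import Data.Integer.Tactic.RingSolver using (solve-∀)
open import Algebra.Properties.CommutativeSemigroup +-commutativeSemigroup using (x∙yz≈y∙xz)
open import Data.List using ([]; _∷_; _++_; foldr; replicate)
open import Data.Product using (_,_)
open import Function.Bundles using (mk⇔)
open import Function.Construct.Composition using (_⇔-∘_)
open import Function.Construct.Symmetry using (⇔-sym)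
open import Relation.Binary.Bundles using (Setoid)
open import Relation.Nullary using (contradiction)
open import Relation.Binary.PropositionalEquality using (refl; sym; trans; cong; subst)
import Relation.Binary.Reasoning.Setoid as SetoidReasoning

private
  variable
    a b c : ℤ
    m : ℕ

infix 4 _≡_mod_

-- A record rather than an alias, so that a and b are inferable (_-_ is not injective).
record _≡_mod_ (a b : ℤ) (m : ℕ) : Set where
  constructor congruent
  field
    divides-difference : + m ∣ a - b

≡-mod-refl : a ≡ a mod m
≡-mod-refl {a} = congruent (divides 0ℤ (+-inverseʳ a))

≡-mod-sym : a ≡ b mod m → b ≡ a mod m
≡-mod-sym {a} {b} {m} (congruent m∣a-b) =
  congruent (subst (+ m ∣_) (neg-minus a b) (∣m⇒∣-m m∣a-b))
  where
  neg-minus : ∀ a b → - (a - b) ≡ b - a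
  neg-minus = solve-∀

≡-mod-trans : a ≡ b mod m → b ≡ c mod m → a ≡ c mod m
≡-mod-trans {a} {b} {m} {c} (congruent m∣a-b) (congruent m∣b-c) =
  congruent (subst (+ m ∣_) (+-minus-telescope a b c) (∣m∣n⇒∣m+n m∣a-b m∣b-c))

≡-mod-setoid : ℕ → Setoid 0ℓ 0ℓ
≡-mod-setoid m = record
  { Carrier       = ℤ
  ; _≈_           = λ a b → a ≡ b mod m
  ; isEquivalence = record { refl = ≡-mod-refl ; sym = ≡-mod-sym ; trans = ≡-mod-trans }
  }

≡-mod-⇔ : a ≡ b mod m → (a ≡ c mod m) ⇔ (b ≡ c mod m)
≡-mod-⇔ a≡b = mk⇔ (≡-mod-trans (≡-mod-sym a≡b)) (≡-mod-trans a≡b)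

[c+a]-[c+b]≡a-b : ∀ c a b → (c + a) - (c + b) ≡ a - b
[c+a]-[c+b]≡a-b = solve-∀

+-congˡ-≡-mod : ∀ c → a ≡ b mod m → c + a ≡ c + b mod m
+-congˡ-≡-mod {a} {b} {m} c (congruent m∣a-b) =
  congruent (subst (+ m ∣_) (sym ([c+a]-[c+b]≡a-b c a b)) m∣a-b)

+-cancelˡ-≡-mod : ∀ c → c + a ≡ c + b mod m → a ≡ b mod m
+-cancelˡ-≡-mod {a} {b} {m} c (congruent m∣c+a-[c+b]) =
  congruent (subst (+ m ∣_) ([c+a]-[c+b]≡a-b c a b) m∣c+a-[c+b])

neg-cong-≡-mod : a ≡ b mod m → - a ≡ - b mod m
neg-cong-≡-mod {a} {b} {m} (congruent m∣a-b) =
  congruent (subst (+ m ∣_) (neg-minus a b) (∣m⇒∣-m m∣a-b))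
  where
  neg-minus : ∀ a b → - (a - b) ≡ - a - - b
  neg-minus = solve-∀

≡-mod-reflect : a + b ≡ c + c → a ≡ c mod m → b ≡ c mod m
≡-mod-reflect {a} {b} {c} {m} a+b≡2c a≡c = begin
  b             ≡⟨ add-sub a b ⟩
  (a + b) - a   ≡⟨ cong (_- a) a+b≡2c ⟩
  (c + c) - a   ≈⟨ +-congˡ-≡-mod (c + c) (neg-cong-≡-mod a≡c) ⟩
  (c + c) - c   ≡⟨ add-sub c c ⟨
  c             ∎
  where
  open SetoidReasoning (≡-mod-setoid m)
  add-sub : ∀ a b → b ≡ (a + b) - a
  add-sub = solve-∀

≡-mod-%ℕ : ∀ a d .{{_ : NonZero d}} → a ≡ + (a %ℕ d) mod d
≡-mod-%ℕ a d = congruent (divides (a /ℕ d) (begin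
  a - + (a %ℕ d)                              ≡⟨ cong (_- + (a %ℕ d)) (a≡a%ℕn+[a/ℕn]*n a d) ⟩
  (+ (a %ℕ d) + (a /ℕ d) * + d) - + (a %ℕ d)  ≡⟨ add-sub (+ (a %ℕ d)) ((a /ℕ d) * + d) ⟩
  (a /ℕ d) * + d                              ∎))
  where
  open Relation.Binary.PropositionalEquality.≡-Reasoning
  add-sub : ∀ a b → (a + b) - a ≡ b
  add-sub = solve-∀

∣-<⇒≡0 : ∀ {d k} → d ∣ℕ k → k ℕ.< d → k ≡ 0
∣-<⇒≡0 {k = zero}  _   _   = refl
∣-<⇒≡0 {k = suc k} d∣k k<d = contradiction d∣k (>⇒∤ k<d)

≡-mod-<⇒≡ : ∀ {d r s} → r ℕ.< d → s ℕ.< d → + r ≡ + s mod d → r ≡ s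
≡-mod-<⇒≡ {d} {r} {s} r<d s<d (congruent d∣r-s) =
  +-injective (i-j≡0⇒i≡j (+ r) (+ s) (∣i∣≡0⇒i≡0 (∣-<⇒≡0 (∣⇒∣ᵤ d∣r-s) distance<d)))
  where
  distance<d : ∣ + r - + s ∣ ℕ.< d
  distance<d = ≤-<-trans
    (subst (ℕ._≤ r ℕ.⊔ s) (cong ∣_∣ (sym (m-n≡m⊖n r s))) (∣m⊝n∣≤m⊔n r s))
    (⊔-lub r<d s<d)

%ℕ≡⇔≡-mod : ∀ a {d r} .{{_ : NonZero d}} → r ℕ.< d → (a %ℕ d ≡ r) ⇔ (a ≡ + r mod d)
%ℕ≡⇔≡-mod a {d} r<d = mk⇔
  (λ a%d≡r → subst (λ r → a ≡ + r mod d) a%d≡r (≡-mod-%ℕ a d))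
  (λ a≡r → ≡-mod-<⇒≡ (n%ℕd<d a d) r<d (≡-mod-trans (≡-mod-sym (≡-mod-%ℕ a d)) a≡r))

signed : Bool → ℤ → ℤ
signed false a = a
signed true  a = - a

signed-not : ∀ p a → signed (not p) a ≡ - signed p a
signed-not false a = refl
signed-not true  a = sym (neg-involutive a)

signed-signed : ∀ p q a → signed p (signed q a) ≡ signed (xor p q) a
signed-signed false q a = refl
signed-signed true  q a = sym (signed-not q a)

sign-+-signed : ∀ p h a → sign p h + signed p a ≡ signed p (+ h + a)
sign-+-signed false h a = refl
sign-+-signed true  h a = sym (neg-distrib-+ (+ h) a)

act : Bool → ℤ → ℤ
act true  a = 1ℤ + a
act false a = - a

-- signedCount w = Σ_{heads} (-1)^(tails to their left) - (-1)^(tails in w).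
signedCount : Word → ℤ
signedCount = foldr act -1ℤ

signedCount-replicate-true : ∀ h w → signedCount (replicate h true ++ w) ≡ + h + signedCount w
signedCount-replicate-true zero    w = sym (+-identityˡ (signedCount w))
signedCount-replicate-true (suc h) w = trans (cong (_+_ 1ℤ) (signedCount-replicate-true h w))
                                             (sym (+-assoc 1ℤ (+ h) (signedCount w)))

signedCount-replicate-false : ∀ t w → signedCount (replicate t false ++ w) ≡ signed (odd t) (signedCount w)
signedCount-replicate-false zero    w = refl
signedCount-replicate-false (suc t) w = trans (cong -_ (signedCount-replicate-false t w))
                                              (sym (signed-not (odd t) (signedCount w)))

-- Since -p ≡ 1 - (-1)^p (mod 3), the final -p of S matches the final -(-1)^p of signedCount.
S-rest≡1+signedCount : ∀ p ds → S-rest p ds ≡ 1ℤ + signed p (signedCount (decode-rest ds)) mod 3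
S-rest≡1+signedCount false []             = ≡-mod-refl
S-rest≡1+signedCount true  []             = congruent (divides -1ℤ refl)
S-rest≡1+signedCount p     ((t , h) ∷ ds) = begin
  sign p′ h + S-rest p′ ds
    ≈⟨ +-congˡ-≡-mod (sign p′ h) (S-rest≡1+signedCount p′ ds) ⟩
  sign p′ h + (1ℤ + signed p′ σ)
    ≡⟨ x∙yz≈y∙xz (sign p′ h) 1ℤ (signed p′ σ) ⟩
  1ℤ + (sign p′ h + signed p′ σ)
    ≡⟨ cong (_+_ 1ℤ) (sign-+-signed p′ h σ) ⟩
  1ℤ + signed p′ (+ h + σ)
    ≡⟨ cong (λ x → 1ℤ + signed p′ x) (signedCount-replicate-true h rest) ⟨
  1ℤ + signed p′ (signedCount heads)
    ≡⟨ cong (_+_ 1ℤ) (signed-signed p (odd t) (signedCount heads)) ⟨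
  1ℤ + signed p (signed (odd t) (signedCount heads))
    ≡⟨ cong (λ x → 1ℤ + signed p x) (signedCount-replicate-false t heads) ⟨
  1ℤ + signed p (signedCount (replicate t false ++ heads))
    ∎
  where
  open SetoidReasoning (≡-mod-setoid 3)
  p′    = xor p (odd t)
  rest  = decode-rest ds
  σ     = signedCount rest
  heads = replicate h true ++ rest

S≡1+signedCount : ∀ D → S D ≡ 1ℤ + signedCount (decode D) mod 3
S≡1+signedCount (decomp h₀ ds) = begin
  + h₀ + S-rest false ds                        ≈⟨ +-congˡ-≡-mod (+ h₀) (S-rest≡1+signedCount false ds) ⟩
  + h₀ + (1ℤ + signedCount rest)                ≡⟨ x∙yz≈y∙xz (+ h₀) 1ℤ (signedCount rest) ⟩
  1ℤ + (+ h₀ + signedCount rest)                ≡⟨ cong (_+_ 1ℤ) (signedCount-replicate-true h₀ rest) ⟨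
  1ℤ + signedCount (replicate h₀ true ++ rest)  ∎
  where
  open SetoidReasoning (≡-mod-setoid 3)
  rest = decode-rest ds

S%3≡2⇔signedCount≡1 : ∀ D → (S D %ℕ 3 ≡ 2) ⇔ (signedCount (decode D) ≡ 1ℤ mod 3)
S%3≡2⇔signedCount≡1 D =
  mk⇔ (+-cancelˡ-≡-mod 1ℤ) (+-congˡ-≡-mod 1ℤ)
    ⇔-∘ (≡-mod-⇔ (S≡1+signedCount D) ⇔-∘ %ℕ≡⇔≡-mod (S D) (n<1+n 2))

act-cong-≡-mod : ∀ x → a ≡ b mod m → act x a ≡ act x b mod m
act-cong-≡-mod true  = +-congˡ-≡-mod 1ℤ
act-cong-≡-mod false = neg-cong-≡-mod

1+act+act-not≡2 : ∀ y a → (1ℤ + act y a) + act (not y) a ≡ + 2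
1+act+act-not≡2 false a = identity a
  where
  identity : ∀ a → (1ℤ + - a) + (1ℤ + a) ≡ + 2
  identity = solve-∀
1+act+act-not≡2 true  a = identity a
  where
  identity : ∀ a → (1ℤ + (1ℤ + a)) + - a ≡ + 2
  identity = solve-∀

act-≡-mod-act-not : ∀ x {u v} → u + v ≡ + 2 → act x u ≡ act (not x) v mod 3
act-≡-mod-act-not true  {u} {v} u+v≡2 =
  congruent (divides 1ℤ (trans (identity u v) (cong (_+_ 1ℤ) u+v≡2)))
  where
  identity : ∀ u v → (1ℤ + u) - - v ≡ 1ℤ + (u + v)
  identity = solve-∀
act-≡-mod-act-not false {u} {v} u+v≡2 =
  congruent (divides -1ℤ (trans (identity u v) (cong (λ s → - (1ℤ + s)) u+v≡2)))
  where
  identity : ∀ u v → - u - (1ℤ + v) ≡ - (1ℤ + (u + v))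
  identity = solve-∀

signedCount-move-non-first : ∀ x L R →
  signedCount ((x ∷ L) ++ true ∷ R) ≡ signedCount (flipLast (x ∷ L) ++ flipHead R) mod 3
signedCount-move-non-first false []      []      = ≡-mod-refl
signedCount-move-non-first true  []      []      = ≡-mod-refl
signedCount-move-non-first x     []      (y ∷ w) = act-≡-mod-act-not x (1+act+act-not≡2 y (signedCount w))
signedCount-move-non-first x     (y ∷ L) R       = act-cong-≡-mod x (signedCount-move-non-first y L R)

signedCount-move : ∀ {A A′} → Move A A′ → true ∈ A′ →
  (signedCount A ≡ 1ℤ mod 3) ⇔ (signedCount A′ ≡ 1ℤ mod 3)
signedCount-move (move []      [])      ()
signedCount-move (move []      (y ∷ w)) _ =
  mk⇔ (≡-mod-reflect sum) (≡-mod-reflect (trans (+-comm after before) sum))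
  where
  before = signedCount (true ∷ y ∷ w)
  after  = signedCount (not y ∷ w)
  sum : before + after ≡ + 2
  sum = 1+act+act-not≡2 y (signedCount w)
signedCount-move (move (x ∷ L) R)       _ = ≡-mod-⇔ (signedCount-move-non-first x L R)

lemma2 : (A A' : Word) → true ∈ A → true ∈ A' → Move A A' →
         (D D' : Decomp) → NonEmptyRest D → NonEmptyRest D' →
         decode D ≡ A → decode D' ≡ A' →
         ((S D %ℕ 3) ≡ 2) ⇔ ((S D' %ℕ 3) ≡ 2)
lemma2 _ _ _ 1∈A′ A→A′ D D′ _ _ refl refl =
  ⇔-sym (S%3≡2⇔signedCount≡1 D′) ⇔-∘ (signedCount-move A→A′ 1∈A′ ⇔-∘ S%3≡2⇔signedCount≡1 D)
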